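{- For any (finite) tree $T$, the dominating graph $\mathcal{D}(T)$ has a Hamilton path.
   Context: All graphs are finite and simple. For a graph $H$, a dominating set of $H$ is a set $D\subseteq V(H)$ such that every vertex of $V(H)\setminus D$ is adjacent to a vertex of $D$. The dominating graph $\mathcal{D}(H)$ is the graph whose vertices are all dominating sets of $H$, in which two distinct dominating sets $X,Y$ are adjacent if and only if $Y$ is obtained from $X$ by adding a single vertex of $H$ or deleting a single vertex of $X$ (i.e. $|X\triangle Y|=1$). -}

module Defs where

open import Data.Nat using (ℕ; _≤_)
open import Data.Bool using (Bool; true; false)
open import Data.Fin using (Fin)
open import Data.Fin.Subset using (Subset; _∈_)
open import Data.Vec using (lookup)
open import Data.List using (List; length; head; last)
open import Data.Maybe using (Maybe; just)
open import Data.List.Relation.Unary.Linked using (Linked)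
open import Data.List.Relation.Unary.Unique.Propositional using (Unique)
open import Data.List.Relation.Unary.All using (All)
import Data.List.Membership.Propositional as LM
open import Data.Product using (Σ; ∃; ∃-syntax; _×_)
open import Data.Sum using (_⊎_)
open import Relation.Binary.PropositionalEquality using (_≡_; _≢_)
open import Relation.Nullary using (¬_)

record Graph (n : ℕ) : Set where
  field
    adj   : Fin n → Fin n → Bool
    sym   : ∀ u v → adj u v ≡ adj v u
    irref : ∀ v → adj v v ≡ false

open Graph public

Adj : ∀ {n} → Graph n → Fin n → Fin n → Set
Adj G u v = adj G u v ≡ true

IsWalk : ∀ {n} → Graph n → Fin n → Fin n → List (Fin n) → Set
IsWalk G u v ws = head ws ≡ just u × last ws ≡ just v × Linked (Adj G) ws

Connected : ∀ {n} → Graph n → Set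
Connected G = ∀ u v → ∃[ ws ] IsWalk G u v ws

IsCycle : ∀ {n} → Graph n → List (Fin n) → Set
IsCycle G cs =
  3 ≤ length cs × Unique cs × Linked (Adj G) cs ×
  ∃[ a ] ∃[ b ] (head cs ≡ just a × last cs ≡ just b × Adj G b a)

Acyclic : ∀ {n} → Graph n → Set
Acyclic G = ∀ cs → ¬ IsCycle G cs

IsTree : ∀ {n} → Graph n → Set
IsTree G = Connected G × Acyclic G

Dominating : ∀ {n} → Graph n → Subset n → Set
Dominating G D = ∀ v → v ∈ D ⊎ ∃[ u ] (u ∈ D × Adj G u v)

-- Adjacency in the dominating graph: |X △ Y| = 1.
DomAdj : ∀ {n} → Subset n → Subset n → Set
DomAdj {n} X Y =
  ∃[ i ] (lookup X i ≢ lookup Y i × (∀ j → j ≢ i → lookup X j ≡ lookup Y j))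

HamiltonPathDom : ∀ {n} → Graph n → List (Subset n) → Set
HamiltonPathDom G ps =
  All (Dominating G) ps × Unique ps ×
  (∀ D → Dominating G D → D LM.∈ ps) × Linked DomAdj ps

HasHamiltonPathDom : ∀ {n} → Graph n → Set
HasHamiltonPathDom G = ∃[ ps ] HamiltonPathDom G ps

-- We prove more: for a forest G and all S, R ⊆ V(G), the family 𝒟(S, R) of sets D ⊆ S
-- dominating R has a Hamilton path (possibly empty) in the graph of single-vertex changes.
-- The theorem is the case S = R = V(G). Below, 𝒟(S, R) is
-- DomIn S R and D − v is D [ v ]≔ outside.
--
-- Induct on |S|, choosing v ∈ S ∪ R with at most one neighbour u in S ∪ R. Then either
-- 𝒟(S, R) is empty; or some x ∈ S lies in every member, and D ↦ D − x identifies 𝒟(S, R)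
-- with 𝒟(S − x, R ∖ N[x]); or v ∈ S and 𝒟(S, R) consists of the sets D with
-- D − v ∈ 𝒜 = 𝒟(S − v, R) together with the sets D ∋ v with D − v ∈ ℰ, where ℰ is again
-- some smaller 𝒟(S′, R′) (empty when v dominates nothing of R), and adding u, or another
-- dominator of u, to a member of ℰ yields a member of 𝒜. In the last case cut the path of 𝒜
-- as K ++ M, where K ends in E₀ + x and E₀ starts the path of ℰ; run backwards through
-- K ++ (path of ℰ) with v added, return through K, and zigzag through M, visiting each of
-- its sets with and without v.

module Submission where

open import Data.Bool using (Bool; true; false; not)
import Data.Bool.Properties as Bool
open import Data.Empty using (⊥; ⊥-elim)
open import Data.Fin using (Fin; zero; suc; _≟_)
open import Data.Fin.Properties using (any?; pigeonhole)
import Data.Fin.Properties as Fin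
open import Data.Fin.Subset
  using (Subset; inside; outside; _∈_; _∉_; _⊆_; _⊂_; _∪_; ⊤; Lift) renaming (⊥ to ∅)
open import Data.Fin.Subset.Properties
  using (_∈?_; _⊆?_; Lift?; ⊆-trans; ⊆-refl; ⊆-⊂-trans; p⊂q⇒∣p∣<∣q∣; x∈p∪q⁺; x∈p∪q⁻;
         Empty-unique; ⊆-min; ∈⊤)
open import Data.List using (List; []; _∷_; _++_; _∷ʳ_; map; reverse; head; last; length)
import Data.List as List
open import Data.List.Properties using (unfold-reverse; ++-assoc)
open import Data.List.Membership.Propositional using () renaming (_∈_ to _∈ₗ_; _∉_ to _∉ₗ_)
open import Data.List.Membership.Propositional.Properties
  using (∈-++⁺ˡ; ∈-++⁺ʳ; ∈-++⁻; ∈-map⁺; ∈-map⁻; ∈-∃++; ∈-lookup)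
open import Data.List.Relation.Binary.Disjoint.Propositional using (Disjoint)
open import Data.List.Relation.Unary.All as All using (All; []; _∷_)
import Data.List.Relation.Unary.All.Properties as All
open import Data.List.Relation.Unary.AllPairs using ([]; _∷_)
open import Data.List.Relation.Unary.Any using (here; there)
import Data.List.Relation.Unary.Any.Properties as Any
open import Data.List.Relation.Unary.Linked using (Linked; []; [-]; _∷_)
import Data.List.Relation.Unary.Linked.Properties as Linked
open import Data.List.Relation.Unary.Unique.Propositional using (Unique)
import Data.List.Relation.Unary.Unique.Propositional.Properties as Unique
open import Data.Maybe using (just)
open import Data.Maybe.Relation.Binary.Connected using (Connected; just; just-nothing; nothing-just; nothing)
open import Data.Nat using (ℕ; zero; suc; _+_; _≤_; z≤n; s≤s)
open import Data.Nat.Induction using (<-wellFounded)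
open import Data.Nat.Properties using (≰⇒>; _≤?_; ≤-trans; +-suc; 1+n≰n; m≤n+m; m≤m+n)
open import Data.Product using (∃-syntax; _×_; _,_; proj₁; proj₂)
open import Data.Sum using (_⊎_; inj₁; inj₂; [_,_])
open import Data.Vec using (lookup; tabulate; _[_]≔_)
open import Data.Vec.Properties
  using ([]≔-updates; []≔-minimal; []≔-idempotent; []≔-lookup; lookup∘update; lookup∘update′;
         lookup∘tabulate; []=-injective; []=⇒lookup; lookup⇒[]=)
open import Function.Base using (_∘_; const)
open import Function.Bundles using (_⇔_; mk⇔; Equivalence)
open import Induction.WellFounded using (WellFounded; Acc; acc; module Subrelation)
open import Relation.Binary.Definitions using (Symmetric)
import Relation.Binary.Construct.On as On
open import Relation.Binary.PropositionalEquality using (_≡_; _≢_; refl; sym; trans; cong; subst)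
open import Relation.Nullary using (¬_; yes; no; Dec)
open import Relation.Nullary.Decidable using (_×-dec_; _⊎-dec_; ¬?)

open import Defs hiding (sym; Connected)

module _ {A : Set} where

  last-∷ʳ : ∀ (xs : List A) x → last (xs ∷ʳ x) ≡ just x
  last-∷ʳ []           x = refl
  last-∷ʳ (_ ∷ [])     x = refl
  last-∷ʳ (_ ∷ y ∷ xs) x = last-∷ʳ (y ∷ xs) x

  last-reverse : ∀ (xs : List A) → last (reverse xs) ≡ head xs
  last-reverse []       = refl
  last-reverse (x ∷ xs) = trans (cong last (unfold-reverse x xs)) (last-∷ʳ (reverse xs) x)

  Unique-reverse : ∀ {xs : List A} → Unique xs → Unique (reverse xs)
  Unique-reverse {[]}     []           = []
  Unique-reverse {x ∷ xs} (x∉xs ∷ xs!) = subst Unique (sym (unfold-reverse x xs))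
    (Unique.++⁺ (Unique-reverse xs!) ([] ∷ [])
      λ { (x∈ , here refl) → All.lookup x∉xs (Any.reverse⁻ x∈) refl })

  Unique-++⁻ : ∀ (xs : List A) {ys} → Unique (xs ++ ys) →
               Unique xs × Unique ys × Disjoint xs ys
  Unique-++⁻ []       ys!          = [] , ys! , λ ()
  Unique-++⁻ (x ∷ xs) (x∉ ∷ xsys!) with Unique-++⁻ xs xsys!
  ... | xs! , ys! , xs#ys = All.++⁻ˡ xs x∉ ∷ xs! , ys! , λ
    { (here refl , y∈) → All.lookup (All.++⁻ʳ xs x∉) y∈ refl
    ; (there x∈ , y∈)  → xs#ys (x∈ , y∈) }

  module _ {R : A → A → Set} where

    Linked-reverse : Symmetric R → ∀ {xs} → Linked R xs → Linked R (reverse xs)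
    Linked-reverse R-sym []      = []
    Linked-reverse R-sym [-]     = [-]
    Linked-reverse R-sym {x ∷ y ∷ xs} (r ∷ l) = subst (Linked R) (sym (unfold-reverse x (y ∷ xs)))
      (Linked.++⁺ (Linked-reverse R-sym l)
        (subst (λ m → Connected R m (just x)) (sym (last-reverse (y ∷ xs))) (just (R-sym r)))
        [-])

    Linked-++⁻ : ∀ xs {ys} → Linked R (xs ++ ys) →
                 Linked R xs × Connected R (last xs) (head ys) × Linked R ys
    Linked-++⁻ []           {[]}    l       = [] , nothing , l
    Linked-++⁻ []           {_ ∷ _} l       = [] , nothing-just , l
    Linked-++⁻ (x ∷ [])     {[]}    l       = [-] , just-nothing , []
    Linked-++⁻ (x ∷ [])     {_ ∷ _} (r ∷ l) = [-] , just r , l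
    Linked-++⁻ (x ∷ y ∷ xs)         (r ∷ l) with Linked-++⁻ (y ∷ xs) l
    ... | lxs , c , lys = r ∷ lxs , c , lys

module _ {n : ℕ} where

  Unique-lookup-injective : ∀ {xs : List (Fin n)} → Unique xs →
                            ∀ i j → List.lookup xs i ≡ List.lookup xs j → i ≡ j
  Unique-lookup-injective (x∉ ∷ xs!) zero    zero    _  = refl
  Unique-lookup-injective (x∉ ∷ xs!) zero    (suc j) eq = ⊥-elim (All.lookup x∉ (∈-lookup j) eq)
  Unique-lookup-injective (x∉ ∷ xs!) (suc i) zero    eq = ⊥-elim (All.lookup x∉ (∈-lookup i) (sym eq))
  Unique-lookup-injective (x∉ ∷ xs!) (suc i) (suc j) eq = cong suc (Unique-lookup-injective xs! i j eq)

  Unique⇒length≤ : ∀ {xs : List (Fin n)} → Unique xs → length xs ≤ n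
  Unique⇒length≤ {xs} xs! with length xs ≤? n
  ... | yes ≤n = ≤n
  ... | no  ≰n with pigeonhole (≰⇒> ≰n) (List.lookup xs)
  ...   | i , j , i<j , eq = ⊥-elim (Fin.<-irrefl (Unique-lookup-injective xs! i j eq) i<j)

module _ {n : ℕ} where

  x∉p⇒lookup≡outside : ∀ {p : Subset n} {x} → x ∉ p → lookup p x ≡ outside
  x∉p⇒lookup≡outside {p} {x} x∉ with lookup p x in eq
  ... | true  = ⊥-elim (x∉ (lookup⇒[]= x p eq))
  ... | false = refl

  p[x]≔lookup≡p : ∀ (p : Subset n) x {b} → lookup p x ≡ b → p [ x ]≔ b ≡ p
  p[x]≔lookup≡p p x refl = []≔-lookup p x

  p[x]≔outside≡p : ∀ {p : Subset n} {x} → x ∉ p → p [ x ]≔ outside ≡ p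
  p[x]≔outside≡p {p} {x} x∉ = p[x]≔lookup≡p p x (x∉p⇒lookup≡outside x∉)

  p[x]≔inside≡p : ∀ {p : Subset n} {x} → x ∈ p → p [ x ]≔ inside ≡ p
  p[x]≔inside≡p {p} {x} x∈ = p[x]≔lookup≡p p x ([]=⇒lookup x∈)

  p[x]≔b[x]≔outside≡p : ∀ {p : Subset n} {x} b → x ∉ p → p [ x ]≔ b [ x ]≔ outside ≡ p
  p[x]≔b[x]≔outside≡p {p} {x} b x∉ = trans ([]≔-idempotent p x) (p[x]≔outside≡p x∉)

  p[x]≔outside[x]≔lookup≡p : ∀ (p : Subset n) x → p [ x ]≔ outside [ x ]≔ lookup p x ≡ p
  p[x]≔outside[x]≔lookup≡p p x = trans ([]≔-idempotent p x) ([]≔-lookup p x)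

  x∈p[x]≔inside : ∀ (p : Subset n) x → x ∈ p [ x ]≔ inside
  x∈p[x]≔inside p x = []≔-updates p x

  x∉p[x]≔outside : ∀ (p : Subset n) x → x ∉ p [ x ]≔ outside
  x∉p[x]≔outside p x x∈ with () ← []=-injective x∈ ([]≔-updates p x)

  x∈p⇒x∈p[y]≔b : ∀ {p : Subset n} {x y} b → x ≢ y → x ∈ p → x ∈ p [ y ]≔ b
  x∈p⇒x∈p[y]≔b {p} {x} {y} b x≢y = []≔-minimal p x y x≢y

  x∈p[y]≔b⇒x∈p : ∀ {p : Subset n} {x y b} → x ≢ y → x ∈ p [ y ]≔ b → x ∈ p
  x∈p[y]≔b⇒x∈p {p} {x} {y} {b} x≢y x∈ =
    lookup⇒[]= x p (trans (sym (lookup∘update′ x≢y p b)) ([]=⇒lookup x∈))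

  p[x]≔outside⊆p : ∀ {p : Subset n} {x} → p [ x ]≔ outside ⊆ p
  p[x]≔outside⊆p {p} {x} {y} y∈ with y ≟ x
  ... | yes refl = ⊥-elim (x∉p[x]≔outside p x y∈)
  ... | no  y≢x  = x∈p[y]≔b⇒x∈p y≢x y∈

  p⊆p[x]≔inside : ∀ {p : Subset n} {x} → p ⊆ p [ x ]≔ inside
  p⊆p[x]≔inside {p} {x} {y} y∈ with y ≟ x
  ... | yes refl = x∈p[x]≔inside p x
  ... | no  y≢x  = x∈p⇒x∈p[y]≔b inside y≢x y∈

  x∈p⇒p[x]≔outside⊂p : ∀ {p : Subset n} {x} → x ∈ p → p [ x ]≔ outside ⊂ p
  x∈p⇒p[x]≔outside⊂p {p} {x} x∈p = p[x]≔outside⊆p , x , x∈p , x∉p[x]≔outside p x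

  ⊆-[x]≔outside : ∀ {D S : Subset n} {x} → D ⊆ S → x ∉ D → D ⊆ S [ x ]≔ outside
  ⊆-[x]≔outside {x = x} D⊆S x∉D {y} y∈D with y ≟ x
  ... | yes refl = ⊥-elim (x∉D y∈D)
  ... | no  y≢x  = x∈p⇒x∈p[y]≔b outside y≢x (D⊆S y∈D)

  [x]≔inside-⊆ : ∀ {D S : Subset n} {x} → D ⊆ S → x ∈ S → D [ x ]≔ inside ⊆ S
  [x]≔inside-⊆ {x = x} D⊆S x∈S {y} y∈ with y ≟ x
  ... | yes refl = x∈S
  ... | no  y≢x  = D⊆S (x∈p[y]≔b⇒x∈p y≢x y∈)

  [x]≔outside-⊆ : ∀ {D S : Subset n} {x} → D [ x ]≔ outside ⊆ S [ x ]≔ outside → x ∈ S → D ⊆ S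
  [x]≔outside-⊆ {x = x} D⁻⊆S⁻ x∈S {y} y∈ with y ≟ x
  ... | yes refl = x∈S
  ... | no  y≢x  = p[x]≔outside⊆p (D⁻⊆S⁻ (x∈p⇒x∈p[y]≔b outside y≢x y∈))

⊂-wellFounded : ∀ {n} → WellFounded (_⊂_ {n})
⊂-wellFounded = Subrelation.wellFounded p⊂q⇒∣p∣<∣q∣ (On.wellFounded _ <-wellFounded)

module _ {n : ℕ} where

  DomAdj-sym : Symmetric (DomAdj {n})
  DomAdj-sym (i , X≢Y , agree) = i , (λ e → X≢Y (sym e)) , λ j j≢i → sym (agree j j≢i)

  DomAdj-flip : ∀ (X : Subset n) v b → DomAdj (X [ v ]≔ b) (X [ v ]≔ not b)
  DomAdj-flip X v b = v , differ , agree
    where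
    differ : lookup (X [ v ]≔ b) v ≢ lookup (X [ v ]≔ not b) v
    differ e = Bool.not-¬ refl
      (trans (sym (lookup∘update v X b)) (trans e (lookup∘update v X (not b))))
    agree : ∀ j → j ≢ v → lookup (X [ v ]≔ b) j ≡ lookup (X [ v ]≔ not b) j
    agree j j≢v = trans (lookup∘update′ j≢v X b) (sym (lookup∘update′ j≢v X (not b)))

  DomAdj-update : ∀ {X Y : Subset n} v b → lookup X v ≡ lookup Y v →
                  DomAdj X Y → DomAdj (X [ v ]≔ b) (Y [ v ]≔ b)
  DomAdj-update {X} {Y} v b Xv≡Yv (i , X≢Y , agree) with i ≟ v
  ... | yes refl = ⊥-elim (X≢Y Xv≡Yv)
  ... | no  i≢v  = i , differ , agree′
    where
    differ : lookup (X [ v ]≔ b) i ≢ lookup (Y [ v ]≔ b) i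
    differ e = X≢Y (trans (sym (lookup∘update′ i≢v X b)) (trans e (lookup∘update′ i≢v Y b)))
    agree′ : ∀ j → j ≢ i → lookup (X [ v ]≔ b) j ≡ lookup (Y [ v ]≔ b) j
    agree′ j j≢i with j ≟ v
    ... | yes refl = trans (lookup∘update v X b) (sym (lookup∘update v Y b))
    ... | no  j≢v  = trans (lookup∘update′ j≢v X b)
                       (trans (agree j j≢i) (sym (lookup∘update′ j≢v Y b)))

  DomAdj-remove : ∀ (X : Subset n) {v} → v ∉ X → DomAdj (X [ v ]≔ inside) X
  DomAdj-remove X {v} v∉X =
    subst (DomAdj (X [ v ]≔ inside)) (p[x]≔outside≡p v∉X) (DomAdj-flip X v inside)

record HamPath {n : ℕ} (P : Subset n → Set) : Set where
  field
    path     : List (Subset n)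
    sound    : All P path
    unique   : Unique path
    complete : ∀ {D} → P D → D ∈ₗ path
    linked   : Linked DomAdj path

open HamPath

module _ {n : ℕ} {P Q : Subset n → Set} where

  hamPath-resp : (∀ D → P D ⇔ Q D) → HamPath P → HamPath Q
  hamPath-resp P⇔Q h = record
    { path     = path h
    ; sound    = All.map (Equivalence.to (P⇔Q _)) (sound h)
    ; unique   = unique h
    ; complete = λ q → complete h (Equivalence.from (P⇔Q _) q)
    ; linked   = linked h
    }

hamPath-empty : ∀ {n} {P : Subset n → Set} → (∀ D → ¬ P D) → HamPath P
hamPath-empty ¬P = record
  { path = [] ; sound = [] ; unique = [] ; complete = λ {D} p → ⊥-elim (¬P D p) ; linked = [] }

module _ {n : ℕ} (v : Fin n) where

  [v]≔-injective : ∀ {X Y : Subset n} b → v ∉ X → v ∉ Y → X [ v ]≔ b ≡ Y [ v ]≔ b → X ≡ Y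
  [v]≔-injective b v∉X v∉Y eq = trans (sym (p[x]≔b[x]≔outside≡p b v∉X))
    (trans (cong (_[ v ]≔ outside) eq) (p[x]≔b[x]≔outside≡p b v∉Y))

  Unique-map-[v]≔ : ∀ b {xs} → All (v ∉_) xs → Unique xs → Unique (map (_[ v ]≔ b) xs)
  Unique-map-[v]≔ b []           []         = []
  Unique-map-[v]≔ b (v∉x ∷ v∉xs) (x∉ ∷ xs!) =
    All.map⁺ (All.zipWith (λ (v∉y , x≢y) eq → x≢y ([v]≔-injective b v∉x v∉y eq)) (v∉xs , x∉))
    ∷ Unique-map-[v]≔ b v∉xs xs!

  Linked-map-[v]≔ : ∀ b {xs} → All (v ∉_) xs → Linked DomAdj xs →
                    Linked DomAdj (map (_[ v ]≔ b) xs)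
  Linked-map-[v]≔ b _ []  = []
  Linked-map-[v]≔ b _ [-] = [-]
  Linked-map-[v]≔ b {x ∷ y ∷ _} (v∉x ∷ v∉y ∷ v∉xs) (r ∷ l) =
    DomAdj-update {X = x} {Y = y} v b
      (trans (x∉p⇒lookup≡outside v∉x) (sym (x∉p⇒lookup≡outside v∉y))) r
    ∷ Linked-map-[v]≔ b (v∉y ∷ v∉xs) l

  ∈-map-[v]≔⁻ : ∀ b {xs z} → All (v ∉_) xs → z ∈ₗ map (_[ v ]≔ b) xs →
                z [ v ]≔ outside ∈ₗ xs × lookup z v ≡ b
  ∈-map-[v]≔⁻ b {xs} v∉xs z∈ with ∈-map⁻ (_[ v ]≔ b) z∈
  ... | x , x∈ , refl = subst (_∈ₗ xs) (sym (p[x]≔b[x]≔outside≡p b (All.lookup v∉xs x∈))) x∈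
                      , []=⇒lookup ([]≔-updates x v)

  ∈-map-[v]≔⁺ : ∀ {b xs D} → D [ v ]≔ outside ∈ₗ xs → lookup D v ≡ b →
                D ∈ₗ map (_[ v ]≔ b) xs
  ∈-map-[v]≔⁺ {xs = xs} {D} D⁻∈ refl = subst (_∈ₗ map (_[ v ]≔ lookup D v) xs)
    (p[x]≔outside[x]≔lookup≡p D v) (∈-map⁺ (_[ v ]≔ lookup D v) D⁻∈)

  zigzag : Bool → List (Subset n) → List (Subset n)
  zigzag b []       = []
  zigzag b (m ∷ ms) = m [ v ]≔ b ∷ m [ v ]≔ not b ∷ zigzag (not b) ms

  ∈-zigzag⁻ : ∀ b {ms z} → All (v ∉_) ms → z ∈ₗ zigzag b ms → z [ v ]≔ outside ∈ₗ ms
  ∈-zigzag⁻ b (v∉m ∷ _)  (here refl)         = here (p[x]≔b[x]≔outside≡p b v∉m)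
  ∈-zigzag⁻ b (v∉m ∷ _)  (there (here refl)) = here (p[x]≔b[x]≔outside≡p (not b) v∉m)
  ∈-zigzag⁻ b (_ ∷ v∉ms) (there (there z∈))  = there (∈-zigzag⁻ (not b) v∉ms z∈)

  ∈-zigzag⁺ : ∀ b {ms D} → D [ v ]≔ outside ∈ₗ ms → D ∈ₗ zigzag b ms
  ∈-zigzag⁺ b {ms} {D} D⁻∈ =
    subst (_∈ₗ zigzag b ms) (p[x]≔outside[x]≔lookup≡p D v) (both b (lookup D v) D⁻∈)
    where
    both : ∀ b c {ms m} → m ∈ₗ ms → m [ v ]≔ c ∈ₗ zigzag b ms
    both true  true  (here refl) = here refl
    both false false (here refl) = here refl
    both true  false (here refl) = there (here refl)
    both false true  (here refl) = there (here refl)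
    both b     c     (there m∈)  = there (there (both (not b) c m∈))

  Unique-zigzag : ∀ b {ms} → All (v ∉_) ms → Unique ms → Unique (zigzag b ms)
  Unique-zigzag b {[]}     _            _            = []
  Unique-zigzag b {m ∷ ms} (v∉m ∷ v∉ms) (m∉ms ∷ ms!) =
    All.¬Any⇒All¬ _ fresh ∷ All.¬Any⇒All¬ _ (fresh′ (not b)) ∷ Unique-zigzag (not b) v∉ms ms!
    where
    fresh′ : ∀ c → m [ v ]≔ c ∉ₗ zigzag (not b) ms
    fresh′ c m′∈ = All.lookup m∉ms
      (subst (_∈ₗ ms) (p[x]≔b[x]≔outside≡p c v∉m) (∈-zigzag⁻ (not b) v∉ms m′∈)) refl
    fresh : m [ v ]≔ b ∉ₗ (m [ v ]≔ not b ∷ zigzag (not b) ms)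
    fresh (here eq)   = proj₁ (proj₂ (DomAdj-flip m v b)) (cong (λ X → lookup X v) eq)
    fresh (there m′∈) = fresh′ b m′∈

  Linked-zigzag : ∀ b {ms} → All (v ∉_) ms → Linked DomAdj ms → Linked DomAdj (zigzag b ms)
  Linked-zigzag b _ [] = []
  Linked-zigzag b {m ∷ []} _ [-] = DomAdj-flip m v b ∷ [-]
  Linked-zigzag b {m ∷ m′ ∷ _} (v∉m ∷ v∉m′ ∷ v∉ms) (r ∷ l) =
    DomAdj-flip m v b
    ∷ DomAdj-update {X = m} {Y = m′} v (not b)
        (trans (x∉p⇒lookup≡outside v∉m) (sym (x∉p⇒lookup≡outside v∉m′))) r
    ∷ Linked-zigzag (not b) (v∉m′ ∷ v∉ms) l

  hamPath-insert : ∀ {E : Subset n → Set} → HamPath E → (∀ {D} → E D → v ∉ D) →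
                   HamPath (λ D → v ∈ D × E (D [ v ]≔ outside))
  hamPath-insert {E} h avoids = record
    { path     = map (_[ v ]≔ inside) (path h)
    ; sound    = All.map⁺ (All.map (λ {e} Ee → x∈p[x]≔inside e v
                   , subst E (sym (p[x]≔b[x]≔outside≡p inside (avoids Ee))) Ee) (sound h))
    ; unique   = Unique-map-[v]≔ inside v∉path (unique h)
    ; complete = λ (v∈D , ED⁻) → ∈-map-[v]≔⁺ (complete h ED⁻) ([]=⇒lookup v∈D)
    ; linked   = Linked-map-[v]≔ inside v∉path (linked h)
    }
    where
    v∉path = All.map avoids (sound h)

module Pendant {n : ℕ} (v : Fin n) {A E : Subset n → Set} (hA : HamPath A) (hE : HamPath E)
  (A-avoids : ∀ {D} → A D → v ∉ D) (E-avoids : ∀ {D} → E D → v ∉ D)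
  (E∩A : ∀ {D} → E D → ¬ A D) where

  Split : Subset n → Set
  Split D = A (D [ v ]≔ outside) ⊎ (v ∈ D × E (D [ v ]≔ outside))

  module _ (L : List (Subset n)) (c : Subset n) (M : List (Subset n)) (path≡ : path hA ≡ (L ∷ʳ c) ++ M)
           (c~E : Connected DomAdj (just c) (head (path hE))) where

    K pe W : List (Subset n)
    K  = L ∷ʳ c
    pe = path hE
    W  = K ++ pe

    up down : List (Subset n)
    up   = reverse (map (_[ v ]≔ inside) W)
    down = K ++ zigzag v outside M

    A-KM : All A (K ++ M)
    A-KM = subst (All A) path≡ (sound hA)

    KM! : Unique (K ++ M)
    KM! = subst Unique path≡ (unique hA)

    KM~ : Linked DomAdj (K ++ M)
    KM~ = subst (Linked DomAdj) path≡ (linked hA)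

    A-K : All A K
    A-K = All.++⁻ˡ K A-KM

    A-M : All A M
    A-M = All.++⁻ʳ K A-KM

    v∉K : All (v ∉_) K
    v∉K = All.map A-avoids A-K

    v∉M : All (v ∉_) M
    v∉M = All.map A-avoids A-M

    v∉W : All (v ∉_) W
    v∉W = All.++⁺ v∉K (All.map E-avoids (sound hE))

    K! : Unique K
    K! = proj₁ (Unique-++⁻ K KM!)

    M! : Unique M
    M! = proj₁ (proj₂ (Unique-++⁻ K KM!))

    K#M : ∀ {z} → z ∈ₗ K → z ∉ₗ M
    K#M z∈K z∈M = proj₂ (proj₂ (Unique-++⁻ K KM!)) (z∈K , z∈M)

    pe#A : ∀ {z xs} → All A xs → z ∈ₗ pe → z ∉ₗ xs
    pe#A A-xs z∈pe z∈xs = E∩A (All.lookup (sound hE) z∈pe) (All.lookup A-xs z∈xs)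

    ∈up⁻ : ∀ {z} → z ∈ₗ up → z [ v ]≔ outside ∈ₗ W × lookup z v ≡ inside
    ∈up⁻ z∈ = ∈-map-[v]≔⁻ v inside v∉W (Any.reverse⁻ z∈)

    ∈zigzag⁻ : ∀ {z} → z ∈ₗ zigzag v outside M → z [ v ]≔ outside ∈ₗ M
    ∈zigzag⁻ = ∈-zigzag⁻ v outside v∉M

    sound-path : All Split (up ++ down)
    sound-path = All.tabulate λ z∈ → split (∈-++⁻ up z∈)
      where
      split : ∀ {z} → z ∈ₗ up ⊎ z ∈ₗ down → Split z
      split {z} (inj₁ z∈up) with ∈up⁻ z∈up
      ... | z⁻∈W , zv with ∈-++⁻ K z⁻∈W
      ...   | inj₁ z⁻∈K  = inj₁ (All.lookup A-K z⁻∈K)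
      ...   | inj₂ z⁻∈pe = inj₂ (lookup⇒[]= v z zv , All.lookup (sound hE) z⁻∈pe)
      split {z} (inj₂ z∈down) with ∈-++⁻ K z∈down
      ... | inj₁ z∈K  =
        inj₁ (subst A (sym (p[x]≔outside≡p (All.lookup v∉K z∈K))) (All.lookup A-K z∈K))
      ... | inj₂ z∈zz = inj₁ (All.lookup A-M (∈zigzag⁻ z∈zz))

    unique-path : Unique (up ++ down)
    unique-path = Unique.++⁺ up! down! up#down
      where
      up! : Unique up
      up! = Unique-reverse (Unique-map-[v]≔ v inside v∉W
              (Unique.++⁺ K! (unique hE) λ (z∈K , z∈pe) → pe#A A-K z∈pe z∈K))
      down! : Unique down
      down! = Unique.++⁺ K! (Unique-zigzag v outside v∉M M!) λ (z∈K , z∈zz) →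
        K#M z∈K (subst (_∈ₗ M) (p[x]≔outside≡p (All.lookup v∉K z∈K)) (∈zigzag⁻ z∈zz))
      up#down : Disjoint up down
      up#down (z∈up , z∈down) with ∈up⁻ z∈up | ∈-++⁻ K z∈down
      ... | _ , zv   | inj₁ z∈K  = All.lookup v∉K z∈K (lookup⇒[]= v _ zv)
      ... | z⁻∈W , _ | inj₂ z∈zz with ∈-++⁻ K z⁻∈W
      ...   | inj₁ z⁻∈K  = K#M z⁻∈K (∈zigzag⁻ z∈zz)
      ...   | inj₂ z⁻∈pe = pe#A A-M z⁻∈pe (∈zigzag⁻ z∈zz)

    complete-path : ∀ {D} → Split D → D ∈ₗ up ++ down
    complete-path {D} (inj₁ AD⁻) with ∈-++⁻ K (subst (_ ∈ₗ_) path≡ (complete hA AD⁻)) | lookup D v in Dv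
    ... | inj₁ D⁻∈K | true  = ∈-++⁺ˡ (Any.reverse⁺ (∈-map-[v]≔⁺ v (∈-++⁺ˡ D⁻∈K) Dv))
    ... | inj₁ D⁻∈K | false =
      ∈-++⁺ʳ up (∈-++⁺ˡ (subst (_∈ₗ K) (p[x]≔lookup≡p D v Dv) D⁻∈K))
    ... | inj₂ D⁻∈M | _     = ∈-++⁺ʳ up (∈-++⁺ʳ K (∈-zigzag⁺ v outside D⁻∈M))
    complete-path (inj₂ (v∈D , ED⁻)) =
      ∈-++⁺ˡ (Any.reverse⁺ (∈-map-[v]≔⁺ v (∈-++⁺ʳ K (complete hE ED⁻)) ([]=⇒lookup v∈D)))

    linked-path : Linked DomAdj (up ++ down)
    linked-path = Linked.++⁺ up~
      (subst (λ m → Connected DomAdj m (head down)) (sym (last-reverse _)) (up~down L v∉K)) down~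
      where
      up~ : Linked DomAdj up
      up~ = Linked-reverse {R = DomAdj} (λ {X} {Y} → DomAdj-sym {x = X} {Y})
        (Linked-map-[v]≔ v inside v∉W (Linked.++⁺ (proj₁ (Linked-++⁻ K KM~))
          (subst (λ m → Connected DomAdj m (head pe)) (sym (last-∷ʳ L c)) c~E) (linked hE)))
      K~zigzag : ∀ ms → All (v ∉_) ms → Connected DomAdj (last K) (head ms) →
                 Connected DomAdj (last K) (head (zigzag v outside ms))
      K~zigzag []      _         K~ms = K~ms
      K~zigzag (m ∷ _) (v∉m ∷ _) K~ms =
        subst (λ y → Connected DomAdj (last K) (just y)) (sym (p[x]≔outside≡p v∉m)) K~ms
      down~ : Linked DomAdj down
      down~ with Linked-++⁻ K KM~
      ... | K~ , K~M , M~ = Linked.++⁺ K~ (K~zigzag M v∉M K~M) (Linked-zigzag v outside v∉M M~)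
      up~down : ∀ L′ → All (v ∉_) (L′ ∷ʳ c) →
                Connected DomAdj (head (map (_[ v ]≔ inside) ((L′ ∷ʳ c) ++ pe)))
                                 (head ((L′ ∷ʳ c) ++ zigzag v outside M))
      up~down []      (v∉c ∷ _) = just (DomAdj-remove c v∉c)
      up~down (l ∷ _) (v∉l ∷ _) = just (DomAdj-remove l v∉l)

    splitPath : HamPath Split
    splitPath = record
      { path = up ++ down ; sound = sound-path ; unique = unique-path ; complete = complete-path ; linked = linked-path }

  hamPath-pendant : (∀ {D} → E D → ∃[ x ] A (D [ x ]≔ inside)) → HamPath Split
  hamPath-pendant attach with path hE in pe≡ | path hA in pa≡
  ... | [] | [] = hamPath-empty λ
    { D (inj₁ AD⁻)       → ∉[] (subst (_ ∈ₗ_) pa≡ (complete hA AD⁻))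
    ; D (inj₂ (_ , ED⁻)) → ∉[] (subst (_ ∈ₗ_) pe≡ (complete hE ED⁻)) }
    where
    ∉[] : ∀ {D : Subset n} → D ∉ₗ []
    ∉[] ()
  ... | [] | a ∷ as = splitPath [] a as pa≡ (subst (Connected DomAdj (just a) ∘ head) (sym pe≡) just-nothing)
  ... | e ∷ _ | _ with attach (All.head (subst (All E) pe≡ (sound hE)))
  ...   | x , Ac with ∈-∃++ (complete hA Ac)
  ...     | L , M , path≡ = splitPath L c M (trans path≡ (sym (++-assoc L (c ∷ []) M)))
                              (subst (Connected DomAdj (just c) ∘ head) (sym pe≡) (just (DomAdj-remove e x∉e)))
    where
    c = e [ x ]≔ inside
    x∉e : x ∉ e
    x∉e x∈e = E∩A (All.head (subst (All E) pe≡ (sound hE))) (subst A (p[x]≔inside≡p x∈e) Ac)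

module Forest {n : ℕ} (G : Graph n) (acyclic : Acyclic G) where

  Adj-sym : ∀ {u v} → Adj G u v → Adj G v u
  Adj-sym {u} {v} uv = trans (Graph.sym G v u) uv

  Adj-irrefl : ∀ {v} → ¬ Adj G v v
  Adj-irrefl {v} vv with () ← trans (sym vv) (irref G v)

  IsLeafOf : Subset n → Fin n → Set
  IsLeafOf U v = v ∈ U × (∀ {a b} → a ∈ U → b ∈ U → Adj G v a → Adj G v b → a ≡ b)

  -- Otherwise z would close a cycle with the part of the path up to z.
  fresh-neighbour : ∀ {x y z zs} → Unique (x ∷ y ∷ zs) → Linked (Adj G) (x ∷ y ∷ zs) →
                    Adj G x z → z ≢ y → z ∉ₗ x ∷ y ∷ zs
  fresh-neighbour {x} {y} {z} path! path~ xz z≢y z∈ with ∈-∃++ z∈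
  ... | []         , _    , refl = Adj-irrefl xz
  ... | _ ∷ []     , _    , refl = z≢y refl
  ... | _ ∷ p ∷ ps , rest , refl = acyclic cycle
    ( 3≤length ps , proj₁ (Unique-++⁻ cycle (subst Unique split path!))
    , proj₁ (Linked-++⁻ cycle (subst (Linked (Adj G)) split path~))
    , x , z , refl , last-∷ʳ (x ∷ p ∷ ps) z , Adj-sym xz )
    where
    cycle = x ∷ p ∷ ps ∷ʳ z
    split : x ∷ p ∷ ps ++ z ∷ rest ≡ cycle ++ rest
    split = cong (λ l → x ∷ p ∷ l) (sym (++-assoc ps (z ∷ []) rest))
    3≤length : ∀ qs → 3 ≤ length (x ∷ p ∷ qs ∷ʳ z)
    3≤length []      = s≤s (s≤s (s≤s z≤n))
    3≤length (_ ∷ _) = s≤s (s≤s (s≤s z≤n))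

  module _ (U : Subset n) where

    OtherNeighbour : Fin n → Fin n → Set
    OtherNeighbour x y = ∃[ z ] (z ∈ U × Adj G x z × z ≢ y)

    otherNeighbour? : ∀ x y → Dec (OtherNeighbour x y)
    otherNeighbour? x y = any? λ z → z ∈? U ×-dec adj G x z Bool.≟ true ×-dec ¬? (z ≟ y)

    noOtherNeighbour⇒leaf : ∀ {x y} → x ∈ U → ¬ OtherNeighbour x y → IsLeafOf U x
    noOtherNeighbour⇒leaf {x} {y} x∈U none =
      x∈U , λ a∈ b∈ xa xb → trans (is-y a∈ xa) (sym (is-y b∈ xb))
      where
      is-y : ∀ {a} → a ∈ U → Adj G x a → a ≡ y
      is-y {a} a∈ xa with a ≟ y
      ... | yes a≡y = a≡y
      ... | no  a≢y = ⊥-elim (none (a , a∈ , xa , a≢y))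

    -- By acyclicity the walk never revisits a vertex, so it gets stuck at a leaf within n steps.
    walk : ∀ fuel {x y zs} → x ∈ U → Unique (x ∷ y ∷ zs) → Linked (Adj G) (x ∷ y ∷ zs) →
           n ≤ fuel + length zs → ∃[ v ] IsLeafOf U v
    walk fuel {x} {y} {zs} x∈U path! path~ bound with otherNeighbour? x y
    ... | no  none = x , noOtherNeighbour⇒leaf x∈U none
    ... | yes (z , z∈U , xz , z≢y) with All.¬Any⇒All¬ _ (fresh-neighbour path! path~ xz z≢y) | fuel
    ...   | z∉ | zero  =
      ⊥-elim (1+n≰n (≤-trans (m≤n+m _ 2) (≤-trans (Unique⇒length≤ (z∉ ∷ path!)) bound)))
    ...   | z∉ | suc f = walk f z∈U (z∉ ∷ path!) (Adj-sym xz ∷ path~)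
                           (subst (n ≤_) (sym (+-suc f (length zs))) bound)

    leaf-exists : ∀ {x} → x ∈ U → ∃[ v ] IsLeafOf U v
    leaf-exists {x} x∈U with otherNeighbour? x x
    ... | no  none = x , noOtherNeighbour⇒leaf x∈U none
    ... | yes (y , y∈U , xy , _) = walk n y∈U ((y≢x ∷ []) ∷ [] ∷ []) (Adj-sym xy ∷ [-]) (m≤m+n n 0)
      where
      y≢x : y ≢ x
      y≢x refl = Adj-irrefl xy

module Domination {n : ℕ} (G : Graph n) (acyclic : Acyclic G) where

  open Forest G acyclic

  Covers : Fin n → Fin n → Set
  Covers x w = x ≡ w ⊎ Adj G x w

  covers? : ∀ x w → Dec (Covers x w)
  covers? x w = x ≟ w ⊎-dec adj G x w Bool.≟ true

  Covers-sym : ∀ {x w} → Covers x w → Covers w x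
  Covers-sym (inj₁ refl) = inj₁ refl
  Covers-sym (inj₂ xw)   = inj₂ (Adj-sym xw)

  Dominated : Subset n → Fin n → Set
  Dominated D w = ∃[ x ] (x ∈ D × Covers x w)

  Dominated-mono : ∀ {D D′ w} → D ⊆ D′ → Dominated D w → Dominated D′ w
  Dominated-mono D⊆D′ (x , x∈D , xw) = x , D⊆D′ x∈D , xw

  DomIn : Subset n → Subset n → Subset n → Set
  DomIn S R D = D ⊆ S × Lift (Dominated D) R

  DomIn? : ∀ S R D → Dec (DomIn S R D)
  DomIn? S R D = D ⊆? S ×-dec Lift? (λ w → any? λ x → x ∈? D ×-dec covers? x w) R

  DomIn-mono : ∀ {S S′ R R′ D} → S ⊆ S′ → R′ ⊆ R → DomIn S R D → DomIn S′ R′ D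
  DomIn-mono S⊆S′ R′⊆R (D⊆S , dom) = ⊆-trans D⊆S S⊆S′ , dom ∘ R′⊆R

  DomIn-avoids : ∀ {S R D v} → DomIn (S [ v ]≔ outside) R D → v ∉ D
  DomIn-avoids {S} {v = v} (D⊆S⁻ , _) v∈D = x∉p[x]≔outside S v (D⊆S⁻ v∈D)

  stays : Fin n → Subset n → Fin n → Bool
  stays v R w with covers? v w
  ... | yes _ = outside
  ... | no  _ = lookup R w

  _∖N[_] : Subset n → Fin n → Subset n
  R ∖N[ v ] = tabulate (stays v R)

  ∈∖N⁺ : ∀ {R w v} → w ∈ R → ¬ Covers v w → w ∈ R ∖N[ v ]
  ∈∖N⁺ {R} {w} {v} w∈R ¬vw = lookup⇒[]= w _ (trans (lookup∘tabulate (stays v R) w) w-stays)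
    where
    w-stays : stays v R w ≡ inside
    w-stays with covers? v w
    ... | yes vw = ⊥-elim (¬vw vw)
    ... | no  _  = []=⇒lookup w∈R

  ∈∖N⁻ : ∀ {R w v} → w ∈ R ∖N[ v ] → w ∈ R × ¬ Covers v w
  ∈∖N⁻ {R} {w} {v} w∈ = from-stays (trans (sym (lookup∘tabulate (stays v R) w)) ([]=⇒lookup w∈))
    where
    from-stays : stays v R w ≡ inside → w ∈ R × ¬ Covers v w
    from-stays eq with covers? v w
    from-stays () | yes _
    ... | no ¬vw = lookup⇒[]= w R eq , ¬vw

  Lift-∖N : ∀ {D R v} → Lift (Dominated D) (R ∖N[ v ]) →
            (∀ {w} → w ∈ R → Covers v w → Dominated D w) → Lift (Dominated D) R
  Lift-∖N {v = v} dom near {w} w∈R with covers? v w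
  ... | yes vw  = near w∈R vw
  ... | no  ¬vw = dom (∈∖N⁺ w∈R ¬vw)

  DomIn-remove : ∀ {S R D v} → DomIn S R D →
                 DomIn (S [ v ]≔ outside) (R ∖N[ v ]) (D [ v ]≔ outside)
  DomIn-remove {S} {R} {D} {v} (D⊆S , dom) = D⁻⊆S⁻ , dom⁻
    where
    D⁻⊆S⁻ : D [ v ]≔ outside ⊆ S [ v ]≔ outside
    D⁻⊆S⁻ {x} x∈ with x ≟ v
    ... | yes refl = ⊥-elim (x∉p[x]≔outside D v x∈)
    ... | no  x≢v  = x∈p⇒x∈p[y]≔b outside x≢v (D⊆S (x∈p[y]≔b⇒x∈p x≢v x∈))
    dom⁻ : Lift (Dominated (D [ v ]≔ outside)) (R ∖N[ v ])
    dom⁻ w∈ with ∈∖N⁻ w∈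
    ... | w∈R , ¬vw with dom w∈R
    ...   | x , x∈D , xw with x ≟ v
    ...     | yes refl = ⊥-elim (¬vw xw)
    ...     | no  x≢v  = x , x∈p⇒x∈p[y]≔b outside x≢v x∈D , xw

  DomIn-add : ∀ {S R D v} → v ∈ S → v ∈ D →
              DomIn (S [ v ]≔ outside) (R ∖N[ v ]) (D [ v ]≔ outside) → DomIn S R D
  DomIn-add v∈S v∈D (D⁻⊆S⁻ , dom⁻) =
    [x]≔outside-⊆ D⁻⊆S⁻ v∈S
    , Lift-∖N (Dominated-mono p[x]≔outside⊆p ∘ dom⁻) λ _ vw → _ , v∈D , vw

  DomIn-restore : ∀ {S R D v} → v ∈ S → DomIn (S [ v ]≔ outside) R (D [ v ]≔ outside) → DomIn S R D
  DomIn-restore v∈S (D⁻⊆S⁻ , dom⁻) =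
    [x]≔outside-⊆ D⁻⊆S⁻ v∈S , Dominated-mono p[x]≔outside⊆p ∘ dom⁻

  empty-step : ∀ {S R w} → w ∈ R → (∀ {y} → y ∈ S → ¬ Covers y w) → HamPath (DomIn S R)
  empty-step w∈R ¬cover = hamPath-empty λ
    { D (D⊆S , dom) → let (y , y∈D , yw) = dom w∈R in ¬cover (D⊆S y∈D) yw }

  forced-step : ∀ {S R w x} → w ∈ R → x ∈ S → (∀ {y} → y ∈ S → Covers y w → y ≡ x) →
                HamPath (DomIn (S [ x ]≔ outside) (R ∖N[ x ])) → HamPath (DomIn S R)
  forced-step {x = x} w∈R x∈S only-x h =
    hamPath-resp (λ D → mk⇔ (λ (x∈D , d) → DomIn-add x∈S x∈D d) (λ d → x∈ d , DomIn-remove d))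
      (hamPath-insert x h DomIn-avoids)
    where
    x∈ : ∀ {D} → DomIn _ _ D → x ∈ D
    x∈ (D⊆S , dom) with dom w∈R
    ... | y , y∈D , yw = subst (_∈ _) (only-x (D⊆S y∈D) yw) y∈D

  -- E consists of the sets D ∌ v for which D ∪ {v}, but not D, dominates R within S.
  pendant-step : ∀ {S R v} {E : Subset n → Set} → v ∈ S →
                 HamPath (DomIn (S [ v ]≔ outside) R) → HamPath E →
                 (∀ {D} → E D → DomIn (S [ v ]≔ outside) (R ∖N[ v ]) D) →
                 (∀ {D} → E D → ¬ DomIn (S [ v ]≔ outside) R D) →
                 (∀ {D} → DomIn (S [ v ]≔ outside) (R ∖N[ v ]) D →
                          ¬ DomIn (S [ v ]≔ outside) R D → E D) →
                 (∀ {D} → E D → ∃[ x ] DomIn (S [ v ]≔ outside) R (D [ x ]≔ inside)) →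
                 HamPath (DomIn S R)
  pendant-step {S} {R} {v} v∈S hA hE E-sound E∩A E-complete attach =
    hamPath-resp (λ D → mk⇔ from (to D)) (hamPath-pendant attach)
    where
    open Pendant v hA hE DomIn-avoids (DomIn-avoids ∘ E-sound) E∩A
    from : ∀ {D} → Split D → DomIn S R D
    from (inj₁ a)         = DomIn-restore v∈S a
    from (inj₂ (v∈D , e)) = DomIn-add v∈S v∈D (E-sound e)
    to : ∀ D → DomIn S R D → Split D
    to D d with DomIn? (S [ v ]≔ outside) R (D [ v ]≔ outside) | v ∈? D
    ... | yes a | _       = inj₁ a
    ... | no ¬a | yes v∈D = inj₂ (v∈D , E-complete (DomIn-remove d) ¬a)
    ... | no ¬a | no  v∉D = ⊥-elim (¬a (subst (DomIn _ R) (sym (p[x]≔outside≡p v∉D))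
                                         (⊆-[x]≔outside (proj₁ d) v∉D , proj₂ d)))

  useless-step : ∀ {S R v} → v ∈ S → (∀ {w} → w ∈ R → ¬ Covers v w) →
                 HamPath (DomIn (S [ v ]≔ outside) R) → HamPath (DomIn S R)
  useless-step v∈S useless h = pendant-step {E = const ⊥} v∈S h (hamPath-empty λ _ ()) (λ ()) (λ ())
    (λ (D⊆S⁻ , dom) ¬a → ¬a (D⊆S⁻ , Lift-∖N dom λ w∈R vw → ⊥-elim (useless w∈R vw))) (λ ())

  base-step : ∀ {S} R → (∀ x → x ∉ S) → HamPath (DomIn S R)
  base-step {S} R S-empty with any? (_∈? R)
  ... | yes (w , w∈R) = empty-step w∈R λ {y} y∈S → ⊥-elim (S-empty y y∈S)
  ... | no  R-empty   = record
    { path     = ∅ ∷ []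
    ; sound    = (⊆-min S , λ {w} w∈R → ⊥-elim (R-empty (w , w∈R))) ∷ []
    ; unique   = [] ∷ []
    ; complete = λ (D⊆S , _) → here (Empty-unique λ (x , x∈D) → S-empty x (D⊆S x∈D))
    ; linked   = [-]
    }

  Rec : Subset n → Set
  Rec S = ∀ {S′} → S′ ⊂ S → ∀ R → HamPath (DomIn S′ R)

  module Step {S R : Subset n} (rec : Rec S) {v : Fin n} (leaf : IsLeafOf (S ∪ R) v) where

    S⁻ : Subset n
    S⁻ = S [ v ]≔ outside

    rec⁻ : v ∈ S → ∀ R′ → HamPath (DomIn S⁻ R′)
    rec⁻ v∈S = rec (x∈p⇒p[x]≔outside⊂p v∈S)

    ∈S⇒∈U : ∀ {y} → y ∈ S → y ∈ S ∪ R
    ∈S⇒∈U = x∈p∪q⁺ ∘ inj₁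

    ∈R⇒∈U : ∀ {y} → y ∈ R → y ∈ S ∪ R
    ∈R⇒∈U = x∈p∪q⁺ ∘ inj₂

    isolated : (∀ {y} → y ∈ S ∪ R → ¬ Adj G v y) → HamPath (DomIn S R)
    isolated ¬adj with v ∈? S | v ∈? R
    ... | yes v∈S | no  v∉R = useless-step v∈S useless (rec⁻ v∈S R)
      where
      useless : ∀ {w} → w ∈ R → ¬ Covers v w
      useless w∈R (inj₁ refl) = v∉R w∈R
      useless w∈R (inj₂ vw)   = ¬adj (∈R⇒∈U w∈R) vw
    ... | yes v∈S | yes v∈R = forced-step v∈R v∈S only-v (rec⁻ v∈S (R ∖N[ v ]))
      where
      only-v : ∀ {y} → y ∈ S → Covers y v → y ≡ v
      only-v _   (inj₁ y≡v) = y≡v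
      only-v y∈S (inj₂ yv)  = ⊥-elim (¬adj (∈S⇒∈U y∈S) (Adj-sym yv))
    ... | no  v∉S | yes v∈R = empty-step v∈R none
      where
      none : ∀ {y} → y ∈ S → ¬ Covers y v
      none y∈S (inj₁ refl) = v∉S y∈S
      none y∈S (inj₂ yv)   = ¬adj (∈S⇒∈U y∈S) (Adj-sym yv)
    ... | no  v∉S | no  v∉R = ⊥-elim ([ v∉S , v∉R ] (x∈p∪q⁻ S R (proj₁ leaf)))

    module _ {u : Fin n} (u∈U : u ∈ S ∪ R) (vu : Adj G v u) where

      u≢v : u ≢ v
      u≢v refl = Adj-irrefl vu

      coverer : ∀ {y} → y ∈ S ∪ R → Covers y v → y ≡ v ⊎ y ≡ u
      coverer y∈U (inj₁ y≡v) = inj₁ y≡v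
      coverer y∈U (inj₂ yv)  = inj₂ (proj₂ leaf y∈U u∈U (Adj-sym yv) vu)

      covered : ∀ {w} → w ∈ S ∪ R → Covers v w → w ≡ v ⊎ w ≡ u
      covered w∈U = coverer w∈U ∘ Covers-sym

      pendant₁ : v ∈ S → v ∈ R → u ∈ S → HamPath (DomIn S R)
      pendant₁ v∈S v∈R u∈S =
        pendant-step v∈S (rec⁻ v∈S R) (rec S⁻⁻⊂S (R ∖N[ v ])) E-sound E∩A E-complete attach
        where
        S⁻⁻ : Subset n
        S⁻⁻ = S⁻ [ u ]≔ outside
        S⁻⁻⊂S : S⁻⁻ ⊂ S
        S⁻⁻⊂S = ⊆-⊂-trans p[x]≔outside⊆p (x∈p⇒p[x]≔outside⊂p v∈S)
        u-covers : ∀ {D} → u ∈ D → ∀ {w} → w ∈ R → Covers v w → Dominated D w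
        u-covers u∈D w∈R vw = _ , u∈D ,
          [ (λ { refl → inj₂ (Adj-sym vu) }) , (λ { refl → inj₁ refl }) ] (covered (∈R⇒∈U w∈R) vw)
        E-sound : ∀ {D} → DomIn S⁻⁻ (R ∖N[ v ]) D → DomIn S⁻ (R ∖N[ v ]) D
        E-sound = DomIn-mono p[x]≔outside⊆p ⊆-refl
        E∩A : ∀ {D} → DomIn S⁻⁻ (R ∖N[ v ]) D → ¬ DomIn S⁻ R D
        E∩A (D⊆S⁻⁻ , _) (_ , dom) with dom v∈R
        ... | y , y∈D , yv with coverer (∈S⇒∈U (proj₁ S⁻⁻⊂S (D⊆S⁻⁻ y∈D))) yv
        ...   | inj₁ refl = x∉p[x]≔outside S v (p[x]≔outside⊆p (D⊆S⁻⁻ y∈D))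
        ...   | inj₂ refl = x∉p[x]≔outside S⁻ u (D⊆S⁻⁻ y∈D)
        E-complete : ∀ {D} → DomIn S⁻ (R ∖N[ v ]) D → ¬ DomIn S⁻ R D → DomIn S⁻⁻ (R ∖N[ v ]) D
        E-complete {D} (D⊆S⁻ , dom) ¬a with u ∈? D
        ... | yes u∈D = ⊥-elim (¬a (D⊆S⁻ , Lift-∖N dom (u-covers u∈D)))
        ... | no  u∉D = ⊆-[x]≔outside D⊆S⁻ u∉D , dom
        attach : ∀ {D} → DomIn S⁻⁻ (R ∖N[ v ]) D → ∃[ x ] DomIn S⁻ R (D [ x ]≔ inside)
        attach {D} (D⊆S⁻⁻ , dom) = u
          , [x]≔inside-⊆ (⊆-trans D⊆S⁻⁻ p[x]≔outside⊆p) (x∈p⇒x∈p[y]≔b outside u≢v u∈S)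
          , Lift-∖N (Dominated-mono p⊆p[x]≔inside ∘ dom) (u-covers (x∈p[x]≔inside D u))

      pendant₂ : v ∈ S → v ∉ R → u ∈ R → ∀ {x} → x ∈ S → x ≢ v → Covers x u →
                 HamPath (DomIn S R)
      pendant₂ v∈S v∉R u∈R {x} x∈S x≢v xu =
        pendant-step v∈S (rec⁻ v∈S R) (rec S∖N[u]⊂S (R [ u ]≔ outside)) E-sound E∩A E-complete attach
        where
        S∖N[u]⊆S⁻ : S ∖N[ u ] ⊆ S⁻
        S∖N[u]⊆S⁻ y∈ with ∈∖N⁻ y∈
        ... | y∈S , ¬uy = x∈p⇒x∈p[y]≔b outside (λ { refl → ¬uy (inj₂ (Adj-sym vu)) }) y∈S
        S∖N[u]⊂S : S ∖N[ u ] ⊂ S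
        S∖N[u]⊂S = ⊆-⊂-trans S∖N[u]⊆S⁻ (x∈p⇒p[x]≔outside⊂p v∈S)
        R⁻⊆R∖N[v] : R [ u ]≔ outside ⊆ R ∖N[ v ]
        R⁻⊆R∖N[v] {w} w∈ with w ≟ u
        ... | yes refl = ⊥-elim (x∉p[x]≔outside R u w∈)
        ... | no  w≢u  = ∈∖N⁺ w∈R ¬vw
          where
          w∈R = x∈p[y]≔b⇒x∈p w≢u w∈
          ¬vw : ¬ Covers v w
          ¬vw vw with covered (∈R⇒∈U w∈R) vw
          ... | inj₁ refl = v∉R w∈R
          ... | inj₂ w≡u  = w≢u w≡u
        R∖N[v]⊆R⁻ : R ∖N[ v ] ⊆ R [ u ]≔ outside
        R∖N[v]⊆R⁻ w∈ with ∈∖N⁻ w∈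
        ... | w∈R , ¬vw = x∈p⇒x∈p[y]≔b outside (λ { refl → ¬vw (inj₂ vu) }) w∈R
        E-sound : ∀ {D} → DomIn (S ∖N[ u ]) (R [ u ]≔ outside) D → DomIn S⁻ (R ∖N[ v ]) D
        E-sound = DomIn-mono S∖N[u]⊆S⁻ R∖N[v]⊆R⁻
        E∩A : ∀ {D} → DomIn (S ∖N[ u ]) (R [ u ]≔ outside) D → ¬ DomIn S⁻ R D
        E∩A (D⊆S∖N , _) (_ , dom) with dom u∈R
        ... | y , y∈D , yu = proj₂ (∈∖N⁻ (D⊆S∖N y∈D)) (Covers-sym yu)
        E-complete : ∀ {D} → DomIn S⁻ (R ∖N[ v ]) D → ¬ DomIn S⁻ R D →
                     DomIn (S ∖N[ u ]) (R [ u ]≔ outside) D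
        E-complete {D} (D⊆S⁻ , dom) ¬a = D⊆S∖N , dom ∘ R⁻⊆R∖N[v]
          where
          D⊆S∖N : D ⊆ S ∖N[ u ]
          D⊆S∖N {y} y∈D with covers? u y
          ... | no  ¬uy = ∈∖N⁺ (p[x]≔outside⊆p (D⊆S⁻ y∈D)) ¬uy
          ... | yes uy  = ⊥-elim (¬a (D⊆S⁻ , Lift-∖N dom λ w∈R vw →
                  [ (λ { refl → ⊥-elim (v∉R w∈R) }) , (λ { refl → y , y∈D , Covers-sym uy }) ]
                    (covered (∈R⇒∈U w∈R) vw)))
        attach : ∀ {D} → DomIn (S ∖N[ u ]) (R [ u ]≔ outside) D → ∃[ x ] DomIn S⁻ R (D [ x ]≔ inside)
        attach {D} (D⊆S∖N , dom) = x
          , [x]≔inside-⊆ (⊆-trans D⊆S∖N S∖N[u]⊆S⁻) (x∈p⇒x∈p[y]≔b outside x≢v x∈S) , dom⁺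
          where
          dom⁺ : Lift (Dominated (D [ x ]≔ inside)) R
          dom⁺ {w} w∈R with w ≟ u
          ... | yes refl = x , x∈p[x]≔inside D x , xu
          ... | no  w≢u  = Dominated-mono p⊆p[x]≔inside (dom (x∈p⇒x∈p[y]≔b outside w≢u w∈R))

      v∉S-case : v ∉ S → v ∈ R → HamPath (DomIn S R)
      v∉S-case v∉S v∈R with u ∈? S
      ... | yes u∈S = forced-step v∈R u∈S only-u (rec (x∈p⇒p[x]≔outside⊂p u∈S) (R ∖N[ u ]))
        where
        only-u : ∀ {y} → y ∈ S → Covers y v → y ≡ u
        only-u y∈S yv with coverer (∈S⇒∈U y∈S) yv
        ... | inj₁ refl = ⊥-elim (v∉S y∈S)
        ... | inj₂ y≡u  = y≡u
      ... | no  u∉S = empty-step v∈R none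
        where
        none : ∀ {y} → y ∈ S → ¬ Covers y v
        none y∈S yv with coverer (∈S⇒∈U y∈S) yv
        ... | inj₁ refl = v∉S y∈S
        ... | inj₂ refl = u∉S y∈S

      v∈S∩R-case : v ∈ S → v ∈ R → HamPath (DomIn S R)
      v∈S∩R-case v∈S v∈R with u ∈? S
      ... | yes u∈S = pendant₁ v∈S v∈R u∈S
      ... | no  u∉S = forced-step v∈R v∈S only-v (rec⁻ v∈S (R ∖N[ v ]))
        where
        only-v : ∀ {y} → y ∈ S → Covers y v → y ≡ v
        only-v y∈S yv with coverer (∈S⇒∈U y∈S) yv
        ... | inj₁ y≡v  = y≡v
        ... | inj₂ refl = ⊥-elim (u∉S y∈S)

      v∈S∖R-case : v ∈ S → v ∉ R → HamPath (DomIn S R)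
      v∈S∖R-case v∈S v∉R with u ∈? R
      ... | no  u∉R = useless-step v∈S useless (rec⁻ v∈S R)
        where
        useless : ∀ {w} → w ∈ R → ¬ Covers v w
        useless w∈R vw with covered (∈R⇒∈U w∈R) vw
        ... | inj₁ refl = v∉R w∈R
        ... | inj₂ refl = u∉R w∈R
      ... | yes u∈R with any? (λ y → y ∈? S ×-dec ¬? (y ≟ v) ×-dec covers? y u)
      ...   | yes (x , x∈S , x≢v , xu) = pendant₂ v∈S v∉R u∈R x∈S x≢v xu
      ...   | no  none = forced-step u∈R v∈S only-v (rec⁻ v∈S (R ∖N[ v ]))
        where
        only-v : ∀ {y} → y ∈ S → Covers y u → y ≡ v
        only-v {y} y∈S yu with y ≟ v
        ... | yes y≡v = y≡v
        ... | no  y≢v = ⊥-elim (none (y , y∈S , y≢v , yu))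

      withNeighbour : HamPath (DomIn S R)
      withNeighbour with v ∈? S | v ∈? R
      ... | yes v∈S | yes v∈R = v∈S∩R-case v∈S v∈R
      ... | yes v∈S | no  v∉R = v∈S∖R-case v∈S v∉R
      ... | no  v∉S | yes v∈R = v∉S-case v∉S v∈R
      ... | no  v∉S | no  v∉R = ⊥-elim ([ v∉S , v∉R ] (x∈p∪q⁻ S R (proj₁ leaf)))

    hamPath : HamPath (DomIn S R)
    hamPath with any? (λ u → u ∈? S ∪ R ×-dec adj G v u Bool.≟ true)
    ... | yes (u , u∈U , vu) = withNeighbour u∈U vu
    ... | no  none           = isolated λ y∈U vy → none (_ , y∈U , vy)

  hamPath-DomIn : ∀ S R → HamPath (DomIn S R)
  hamPath-DomIn S = go S (⊂-wellFounded S)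
    where
    go : ∀ S → Acc _⊂_ S → ∀ R → HamPath (DomIn S R)
    go S (acc rs) R with any? (_∈? S)
    ... | no  S-empty   = base-step R λ x x∈S → S-empty (x , x∈S)
    ... | yes (x , x∈S) with leaf-exists (S ∪ R) (x∈p∪q⁺ (inj₁ x∈S))
    ...   | v , leaf = Step.hamPath (λ S′⊂S → go _ (rs S′⊂S)) leaf

theorem1p4 : (n : ℕ) (T : Graph n) → IsTree T → HasHamiltonPathDom T
theorem1p4 n T (_ , acyclic) =
  path h , All.map to (sound h) , unique h , (λ D dom → complete h (from dom)) , linked h
  where
  open Domination T acyclic
  h : HamPath (DomIn ⊤ ⊤)
  h = hamPath-DomIn ⊤ ⊤
  to : ∀ {D} → DomIn ⊤ ⊤ D → Dominating T D
  to (_ , dom) w with dom ∈⊤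
  ... | x , x∈D , inj₁ refl = inj₁ x∈D
  ... | x , x∈D , inj₂ xw   = inj₂ (x , x∈D , xw)
  from : ∀ {D} → Dominating T D → DomIn ⊤ ⊤ D
  from dom = (λ _ → ∈⊤) , λ {w} _ →
    [ (λ w∈D → w , w∈D , inj₁ refl) , (λ (x , x∈D , xw) → x , x∈D , inj₂ xw) ] (dom w)
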